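{- Let $G=(V,E)$ be a graph with arboricity at most $c$ and let $\mu>2c$. Let $M^*$ be the size of a maximum matching of $G$, let $h_\mu$ be the number of vertices of $G$ of degree greater than $\mu$, and let $M_\mu$ be the size of a maximum matching in the subgraph $G_L$ of $G$ induced by the vertices of degree at most $\mu$. Then $$M^*\le h_\mu+M_\mu\le\left(\frac{2\mu}{\mu-2c+1}+1\right)M^*.$$
   Context: A graph has arboricity at most $c$ if its edge set can be partitioned into at most $c$ forests. $G_L$ has vertex set $\{v:\deg_G(v)\le\mu\}$ and contains an edge $(u,v)$ of $G$ iff both $u,v$ have degree at most $\mu$ in $G$ (it may have isolated vertices). -}

module Defs where

open import Data.Bool using (Bool; true; false; if_then_else_; _∧_)
open import Data.Nat using (ℕ; zero; suc; _+_; _*_; _∸_; _≤_; _<_; _>_; _≤ᵇ_)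
open import Data.Nat.ListAction using (sum)
open import Data.Fin using (Fin)
open import Data.List using (List; []; _∷_; length; map; allFin; concatMap; _∷ʳ_)
open import Data.List.Relation.Unary.All using (All)
open import Data.List.Relation.Unary.Linked using (Linked)
open import Data.List.Relation.Unary.Unique.Propositional using (Unique)
open import Data.Product using (Σ; _×_; _,_; ∃)
open import Relation.Binary.PropositionalEquality using (_≡_)
open import Relation.Nullary using (¬_)

record Graph (n : ℕ) : Set where
  field
    Adj    : Fin n → Fin n → Bool
    sym    : ∀ u v → Adj u v ≡ Adj v u
    irrefl : ∀ v → Adj v v ≡ false
open Graph public

Edge : ∀ {n} → Graph n → Fin n → Fin n → Set
Edge G u v = Adj G u v ≡ true

deg : ∀ {n} → Graph n → Fin n → ℕ
deg {n} G v = sum (map (λ u → if Adj G v u then 1 else 0) (allFin n))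

highCount : ∀ {n} → Graph n → ℕ → ℕ
highCount {n} G μ = sum (map (λ v → if deg G v ≤ᵇ μ then 0 else 1) (allFin n))

-- G_L : keep exactly the edges of G whose both endpoints have degree ≤ μ
-- (vertices of degree > μ become isolated; this does not affect matchings).
lowSubgraph : ∀ {n} → Graph n → ℕ → Graph n
lowSubgraph {n} G μ = record
  { Adj    = λ u v → Adj G u v ∧ ((deg G u ≤ᵇ μ) ∧ (deg G v ≤ᵇ μ))
  ; sym    = symL
  ; irrefl = irrL
  }
  where
  open import Data.Bool.Properties using (∧-comm)
  open import Relation.Binary.PropositionalEquality using (cong₂)
  symL : ∀ u v → (Adj G u v ∧ ((deg G u ≤ᵇ μ) ∧ (deg G v ≤ᵇ μ)))
               ≡ (Adj G v u ∧ ((deg G v ≤ᵇ μ) ∧ (deg G u ≤ᵇ μ)))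
  symL u v = cong₂ _∧_ (Graph.sym G u v) (∧-comm (deg G u ≤ᵇ μ) (deg G v ≤ᵇ μ))
  irrL : ∀ v → (Adj G v v ∧ ((deg G v ≤ᵇ μ) ∧ (deg G v ≤ᵇ μ))) ≡ false
  irrL v rewrite Graph.irrefl G v = Relation.Binary.PropositionalEquality.refl

endpoints : ∀ {n} → List (Fin n × Fin n) → List (Fin n)
endpoints = concatMap (λ { (u , v) → u ∷ v ∷ [] })

IsMatching : ∀ {n} → Graph n → List (Fin n × Fin n) → Set
IsMatching G M = All (λ { (u , v) → Edge G u v }) M × Unique (endpoints M)

IsMaxMatchingSize : ∀ {n} → Graph n → ℕ → Set
IsMaxMatchingSize G m =
  (Σ (List _) λ M → IsMatching G M × length M ≡ m) ×
  (∀ M → IsMatching G M → length M ≤ m)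

IsCycle : ∀ {n} → (Fin n → Fin n → Set) → Fin n → List (Fin n) → Set
IsCycle R v ys = Unique (v ∷ ys) × 2 ≤ length ys × Linked R ((v ∷ ys) ∷ʳ v)

-- Arboricity at most c: the edges can be partitioned into c forests,
-- i.e. there is a (symmetric) colouring of the edges by Fin c such that
-- no colour class contains a cycle.
ArboricityAtMost : ∀ {n} → Graph n → ℕ → Set
ArboricityAtMost {n} G c =
  Σ (Fin n → Fin n → Fin c) λ col →
    (∀ u v → col u v ≡ col v u) ×
    (∀ (i : Fin c) v ys →
       ¬ IsCycle (λ a b → Edge G a b × col a b ≡ i) v ys)

-- Each edge of a maximum matching M of G either survives in G_L or has an endpoint of degree
-- > μ, and distinct such edges have distinct such endpoints; hence M* ≤ h_μ + M_μ. For the other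
-- bound, M_μ ≤ M*, and the 2M* endpoints C of M form a vertex cover. A high vertex outside C has
-- its more than μ neighbours in C, while a graph of arboricity ≤ c spans at most c|S| edges on
-- any vertex set S (a nonempty forest has a vertex of degree ≤ 1). So the set H of high vertices
-- outside C satisfies |H|(μ + 1) ≤ c(|H| + 2M*), and h_μ ≤ 2M* + |H| gives h_μ(μ − 2c + 1) ≤ 2μM*.

module Submission where

open import Defs hiding (sym)
open import Data.Bool using (Bool; true; false; _∧_; if_then_else_; T)
import Data.Bool as Bool
open import Data.Bool.Properties using (∧-conicalˡ; ∧-zeroʳ)
open import Data.Nat hiding (_≟_)
import Data.Nat as ℕ
open import Data.Nat.Properties hiding (_≟_)
open import Data.Nat.ListAction using (sum)
open import Data.Nat.Tactic.RingSolver using (solve-∀)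
open import Data.Fin as Fin using (Fin; _≟_)
open import Data.List using (List; []; _∷_; _++_; [_]; _∷ʳ_; length; map; allFin; filter)
open import Data.List.Properties using (++-assoc; length-++; length-tabulate)
open import Data.List.Membership.Propositional using (_∈_; _∉_; find)
open import Data.List.Membership.Propositional.Properties
  using (∈-∃++; ∈-++⁻; ∈-++⁺ˡ; ∈-++⁺ʳ; ∈-allFin; ∈-filter⁺; ∈-filter⁻)
open import Data.List.Relation.Binary.Subset.Propositional using (_⊆_)
open import Data.List.Relation.Binary.Subset.Propositional.Properties using (∷⁺ʳ)
open import Data.List.Relation.Binary.Disjoint.Propositional using (Disjoint)
open import Data.List.Relation.Unary.Any using (here; there; any?)
open import Data.List.Relation.Unary.All as All using (All; []; _∷_)
open import Data.List.Relation.Unary.All.Properties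
  using (anti-mono; ¬Any⇒All¬; ++⁻ˡ; ++⁻ʳ) renaming (++⁺ to All-++⁺)
open import Data.List.Relation.Unary.Unique.Propositional using (Unique; []; _∷_)
open import Data.List.Relation.Unary.Unique.Propositional.Properties
  using (allFin⁺; filter⁺) renaming (++⁺ to Unique-++⁺)
open import Data.List.Relation.Unary.Linked as Linked using (Linked; []; [-]; _∷_)
open import Data.Product using (_×_; _,_; proj₁; proj₂; ∃; ∃₂)
open import Data.Sum using (_⊎_; inj₁; inj₂)
open import Data.Empty using (⊥-elim)
open import Function using (_∘_; _∘′_)
open import Relation.Binary.PropositionalEquality hiding ([_])
open import Relation.Nullary using (Dec; yes; no; does; ¬_)
open import Relation.Nullary.Decidable using (dec-true; _×-dec_; ¬?)
open import Algebra.Properties.CommutativeSemigroup +-commutativeSemigroup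
  using (interchange) renaming (x∙yz≈y∙xz to x+[y+z]≡y+[x+z])
open import Algebra.Properties.CommutativeSemigroup *-commutativeSemigroup
  using () renaming (x∙yz≈y∙xz to x*[y*z]≡y*[x*z])

χ : Bool → ℕ
χ b = if b then 1 else 0

module _ {A : Set} where

  ∑ : List A → (A → ℕ) → ℕ
  ∑ []       f = 0
  ∑ (x ∷ xs) f = f x + ∑ xs f

  syntax ∑ xs (λ x → e) = ∑[ x ∈ xs ] e

  sum-map : ∀ (f : A → ℕ) xs → sum (map f xs) ≡ ∑ xs f
  sum-map f []       = refl
  sum-map f (x ∷ xs) = cong (f x +_) (sum-map f xs)

  ∑-cong : ∀ xs {f g : A → ℕ} → (∀ x → f x ≡ g x) → ∑ xs f ≡ ∑ xs g
  ∑-cong []       f≡g = refl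
  ∑-cong (x ∷ xs) f≡g = cong₂ _+_ (f≡g x) (∑-cong xs f≡g)

  ∑-mono-≤ : ∀ {xs} {f g : A → ℕ} → All (λ x → f x ≤ g x) xs → ∑ xs f ≤ ∑ xs g
  ∑-mono-≤ []       = z≤n
  ∑-mono-≤ (p ∷ ps) = +-mono-≤ p (∑-mono-≤ ps)

  ∑-const : ∀ xs k → ∑[ _ ∈ xs ] k ≡ length xs * k
  ∑-const []       k = refl
  ∑-const (x ∷ xs) k = cong (k +_) (∑-const xs k)

  ∑-+ : ∀ xs (f g : A → ℕ) → ∑[ x ∈ xs ] (f x + g x) ≡ ∑ xs f + ∑ xs g
  ∑-+ []       f g = refl
  ∑-+ (x ∷ xs) f g rewrite ∑-+ xs f g = interchange (f x) (g x) (∑ xs f) (∑ xs g)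

  ∑-++ : ∀ xs ys (f : A → ℕ) → ∑ (xs ++ ys) f ≡ ∑ xs f + ∑ ys f
  ∑-++ []       ys f = refl
  ∑-++ (x ∷ xs) ys f rewrite ∑-++ xs ys f = sym (+-assoc (f x) _ _)

  ∑-remove : ∀ xs x ys (f : A → ℕ) → ∑ (xs ++ x ∷ ys) f ≡ f x + ∑ (xs ++ ys) f
  ∑-remove []        x ys f = refl
  ∑-remove (x′ ∷ xs) x ys f rewrite ∑-remove xs x ys f = x+[y+z]≡y+[x+z] (f x′) (f x) _

  ∑-≥-term : ∀ {xs x} (f : A → ℕ) → x ∈ xs → f x ≤ ∑ xs f
  ∑-≥-term f (here refl)         = m≤m+n _ _
  ∑-≥-term {x′ ∷ _} f (there x∈) = ≤-trans (∑-≥-term f x∈) (m≤n+m _ (f x′))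

  length≡∑1 : ∀ (xs : List A) → length xs ≡ ∑[ _ ∈ xs ] 1
  length≡∑1 xs = trans (sym (*-identityʳ _)) (sym (∑-const xs 1))

∑-swap : ∀ {A B : Set} (xs : List A) (ys : List B) (f : A → B → ℕ) →
         ∑[ x ∈ xs ] ∑[ y ∈ ys ] f x y ≡ ∑[ y ∈ ys ] ∑[ x ∈ xs ] f x y
∑-swap []       ys f = sym (trans (∑-const ys 0) (*-zeroʳ (length ys)))
∑-swap (x ∷ xs) ys f = trans (cong (∑ ys (f x) +_) (∑-swap xs ys f)) (sym (∑-+ ys (f x) _))

module _ {A : Set} where

  ∈-remove : ∀ xs {x y : A} ys → y ∈ xs ++ x ∷ ys → x ≢ y → y ∈ xs ++ ys
  ∈-remove xs ys y∈ x≢y with ∈-++⁻ xs y∈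
  ... | inj₁ y∈xs           = ∈-++⁺ˡ y∈xs
  ... | inj₂ (here refl)    = ⊥-elim (x≢y refl)
  ... | inj₂ (there y∈ys)   = ∈-++⁺ʳ xs y∈ys

  ∑-mono-support : ∀ {xs ys} (f : A → ℕ) → Unique xs →
                   (∀ {x} → x ∈ xs → f x ≢ 0 → x ∈ ys) → ∑ xs f ≤ ∑ ys f
  ∑-mono-support {[]}     f _            _    = z≤n
  ∑-mono-support {x ∷ xs} f (x∉xs ∷ uxs) supp with f x ℕ.≟ 0
  ... | yes fx≡0 rewrite fx≡0 = ∑-mono-support f uxs (supp ∘ there)
  ... | no  fx≢0 with ∈-∃++ (supp (here refl) fx≢0)
  ...   | as , bs , refl = begin
    f x + ∑ xs f          ≤⟨ +-monoʳ-≤ (f x) (∑-mono-support f uxs supp′) ⟩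
    f x + ∑ (as ++ bs) f  ≡⟨ ∑-remove as x bs f ⟨
    ∑ (as ++ x ∷ bs) f    ∎
    where
    open ≤-Reasoning
    supp′ : ∀ {y} → y ∈ xs → f y ≢ 0 → y ∈ as ++ bs
    supp′ y∈xs fy≢0 = ∈-remove as bs (supp (there y∈xs) fy≢0) (All.lookup x∉xs y∈xs)

  Unique-⊆⇒length≤ : ∀ {xs ys : List A} → Unique xs → xs ⊆ ys → length xs ≤ length ys
  Unique-⊆⇒length≤ {xs} {ys} uxs xs⊆ys = begin
    length xs       ≡⟨ length≡∑1 xs ⟩
    ∑[ _ ∈ xs ] 1   ≤⟨ ∑-mono-support (λ _ → 1) uxs (λ x∈ _ → xs⊆ys x∈) ⟩
    ∑[ _ ∈ ys ] 1   ≡⟨ length≡∑1 ys ⟨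
    length ys       ∎
    where open ≤-Reasoning

  length-remove : ∀ xs (x : A) ys → length (xs ++ x ∷ ys) ≡ suc (length (xs ++ ys))
  length-remove []        x ys = refl
  length-remove (x′ ∷ xs) x ys = cong suc (length-remove xs x ys)

  Unique-remove : ∀ xs {x : A} ys → Unique (xs ++ x ∷ ys) → Unique (xs ++ ys)
  Unique-remove []        ys (_ ∷ u)   = u
  Unique-remove (x′ ∷ xs) ys (x′∉ ∷ u) =
    All-++⁺ (++⁻ˡ xs x′∉) (All.tail (++⁻ʳ xs x′∉)) ∷ Unique-remove xs ys u

  Unique-++⁻ˡ : ∀ xs {ys : List A} → Unique (xs ++ ys) → Unique xs
  Unique-++⁻ˡ []       _          = []
  Unique-++⁻ˡ (x ∷ xs) (x∉ ∷ uxs) = ++⁻ˡ xs x∉ ∷ Unique-++⁻ˡ xs uxs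

  Linked-++⁻ˡ : ∀ {R : A → A → Set} xs {ys} → Linked R (xs ++ ys) → Linked R xs
  Linked-++⁻ˡ []           _         = []
  Linked-++⁻ˡ (x ∷ [])     _         = [-]
  Linked-++⁻ˡ (x ∷ y ∷ xs) (r ∷ rs)  = r ∷ Linked-++⁻ˡ (y ∷ xs) rs

  Linked-∷ʳ⁺ : ∀ {R : A → A → Set} xs {y z} → Linked R (xs ∷ʳ y) → R y z → Linked R (xs ∷ʳ y ∷ʳ z)
  Linked-∷ʳ⁺ []           _        ryz = ryz ∷ [-]
  Linked-∷ʳ⁺ (x ∷ [])     (r ∷ _)  ryz = r ∷ ryz ∷ [-]
  Linked-∷ʳ⁺ (x ∷ x′ ∷ xs) (r ∷ rs) ryz = r ∷ Linked-∷ʳ⁺ (x′ ∷ xs) rs ryz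

module Acyclic {n : ℕ} (r : Fin n → Fin n → Bool)
  (r-sym : ∀ a b → r a b ≡ r b a) (r-irrefl : ∀ a → r a a ≡ false) where

  _~_ : Fin n → Fin n → Set
  a ~ b = r a b ≡ true

  ~-sym : ∀ {a b} → a ~ b → b ~ a
  ~-sym {a} {b} a~b = trans (r-sym b a) a~b

  ~-irrefl : ∀ {a b} → a ~ b → a ≢ b
  ~-irrefl {a} a~a refl with trans (sym (r-irrefl a)) a~a
  ... | ()

  degreeIn : List (Fin n) → Fin n → ℕ
  degreeIn S u = ∑[ v ∈ S ] χ (r u v)

  degreeSum : List (Fin n) → ℕ
  degreeSum S = ∑[ u ∈ S ] degreeIn S u

  neighbourIn : ∀ S x → 1 ≤ degreeIn S x → ∃ λ z → z ∈ S × x ~ z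
  neighbourIn (z ∷ S) x d with r x z in x~z
  ... | true  = z , here refl , x~z
  ... | false with w , w∈S , x~w ← neighbourIn S x d = w , there w∈S , x~w

  otherNeighbourIn : ∀ S x y → Unique S → 2 ≤ degreeIn S x → ∃ λ z → z ∈ S × x ~ z × z ≢ y
  otherNeighbourIn (z ∷ S) x y (z∉S ∷ uS) d with r x z in x~z | z ≟ y
  ... | true | no z≢y = z , here refl , x~z , z≢y
  ... | true | yes refl with w , w∈S , x~w ← neighbourIn S x (≤-pred d) =
    w , there w∈S , x~w , (λ w≡z → All.lookup z∉S w∈S (sym w≡z))
  ... | false | _ with w , w∈S , x~w , w≢y ← otherNeighbourIn S x y uS d =
    w , there w∈S , x~w , w≢y

  Cycle : Set
  Cycle = ∃₂ (IsCycle _~_)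

  MinDegree≥2 : List (Fin n) → Set
  MinDegree≥2 S = All (λ u → 2 ≤ degreeIn S u) S

  closeCycle : ∀ x y as z bs → Unique (x ∷ y ∷ as ++ z ∷ bs) → Linked _~_ (x ∷ y ∷ as ++ z ∷ bs) →
               z ~ x → Cycle
  closeCycle x y as z bs u l z~x = x , y ∷ as ++ [ z ] , unique , s≤s 1≤length , linked
    where
    reassoc : x ∷ y ∷ as ++ z ∷ bs ≡ (x ∷ y ∷ as ++ [ z ]) ++ bs
    reassoc = cong (λ l → x ∷ y ∷ l) (sym (++-assoc as [ z ] bs))
    unique : Unique (x ∷ y ∷ as ++ [ z ])
    unique = Unique-++⁻ˡ (x ∷ y ∷ as ++ [ z ]) (subst Unique reassoc u)
    linked : Linked _~_ ((x ∷ y ∷ as ++ [ z ]) ∷ʳ x)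
    linked = Linked-∷ʳ⁺ (x ∷ y ∷ as) (Linked-++⁻ˡ (x ∷ y ∷ as ++ [ z ]) (subst (Linked _~_) reassoc l)) z~x
    1≤length : 1 ≤ length (as ++ [ z ])
    1≤length = subst (1 ≤_) (sym (length-++ as)) (m≤n+m 1 (length as))

  -- Extend a simple path x ∷ y ∷ path at its head by a neighbour of x other than y: unless that
  -- neighbour already lies on the path (closing a cycle), the path grows, which it cannot do forever inside S.
  growPath : ∀ {S} → Unique S → MinDegree≥2 S → ∀ fuel x y path →
             Unique (x ∷ y ∷ path) → Linked _~_ (x ∷ y ∷ path) → All (_∈ S) (x ∷ y ∷ path) →
             length S < length (x ∷ y ∷ path) + fuel → Cycle
  growPath {S} uS _ zero x y path u _ p∈S S<p =
    ⊥-elim (<⇒≱ (subst (length S <_) (+-identityʳ _) S<p) (Unique-⊆⇒length≤ u (All.lookup p∈S)))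
  growPath {S} uS deg≥2 (suc fuel) x y path u l p∈S S<p
    with z , z∈S , x~z , z≢y ← otherNeighbourIn S x y uS (All.lookup deg≥2 (All.head p∈S))
       | any? (z ≟_) path
  ... | no z∉path = growPath uS deg≥2 fuel z x (y ∷ path)
        ((≢-sym (~-irrefl x~z) ∷ z≢y ∷ ¬Any⇒All¬ path z∉path) ∷ u)
        (~-sym x~z ∷ l) (z∈S ∷ p∈S) (subst (length S <_) (+-suc _ fuel) S<p)
  ... | yes z∈path with as , bs , refl ← ∈-∃++ z∈path = closeCycle x y as z bs u l (~-sym x~z)

  minDegree≥2⇒cycle : ∀ {S s} → Unique S → MinDegree≥2 S → s ∈ S → Cycle
  minDegree≥2⇒cycle {S} {s} uS deg≥2 s∈S
    with z , z∈S , s~z ← neighbourIn S s (≤-trans (n≤1+n 1) (All.lookup deg≥2 s∈S)) =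
    growPath uS deg≥2 (length S) z s []
      ((≢-sym (~-irrefl s~z) ∷ []) ∷ [] ∷ []) (~-sym s~z ∷ [-]) (z∈S ∷ s∈S ∷ [])
      (s≤s (n≤1+n _))

  degreeIn-remove-self : ∀ as u bs → degreeIn (as ++ u ∷ bs) u ≡ degreeIn (as ++ bs) u
  degreeIn-remove-self as u bs rewrite ∑-remove as u bs (χ ∘ r u) | r-irrefl u = refl

  degreeSum-remove : ∀ as u bs →
    degreeSum (as ++ u ∷ bs) ≡ degreeIn (as ++ bs) u + (degreeIn (as ++ bs) u + degreeSum (as ++ bs))
  degreeSum-remove as u bs = begin
    degreeSum S                                        ≡⟨ ∑-remove as u bs (degreeIn S) ⟩
    degreeIn S u + ∑[ x ∈ S′ ] degreeIn S x            ≡⟨ cong₂ _+_ (degreeIn-remove-self as u bs) (∑-cong S′ split) ⟩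
    degreeIn S′ u + ∑[ x ∈ S′ ] (χ (r u x) + degreeIn S′ x) ≡⟨ cong (degreeIn S′ u +_) (∑-+ S′ (χ ∘ r u) (degreeIn S′)) ⟩
    degreeIn S′ u + (degreeIn S′ u + degreeSum S′)     ∎
    where
    open ≡-Reasoning
    S = as ++ u ∷ bs
    S′ = as ++ bs
    split : ∀ x → degreeIn S x ≡ χ (r u x) + degreeIn S′ x
    split x = trans (∑-remove as u bs (χ ∘ r x)) (cong (λ b → χ b + degreeIn S′ x) (r-sym x u))

  removeLeaf : ∀ as u bs → degreeIn (as ++ u ∷ bs) u ≤ 1 →
               degreeSum (as ++ bs) ≤ 2 * length (as ++ bs) →
               degreeSum (as ++ u ∷ bs) ≤ 2 * length (as ++ u ∷ bs)
  removeLeaf as u bs deg≤1 ih = begin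
    degreeSum (as ++ u ∷ bs)                                       ≡⟨ degreeSum-remove as u bs ⟩
    degreeIn (as ++ bs) u + (degreeIn (as ++ bs) u + degreeSum (as ++ bs))
      ≤⟨ +-mono-≤ deg′≤1 (+-mono-≤ deg′≤1 ih) ⟩
    1 + (1 + 2 * length (as ++ bs))                                ≡⟨ *-suc 2 (length (as ++ bs)) ⟨
    2 * suc (length (as ++ bs))                                    ≡⟨ cong (2 *_) (length-remove as u bs) ⟨
    2 * length (as ++ u ∷ bs)                                      ∎
    where
    open ≤-Reasoning
    deg′≤1 : degreeIn (as ++ bs) u ≤ 1
    deg′≤1 = subst (_≤ 1) (degreeIn-remove-self as u bs) deg≤1

  acyclic⇒degreeSum≤ : (∀ v ys → ¬ IsCycle _~_ v ys) → ∀ {S} → Unique S → degreeSum S ≤ 2 * length S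
  acyclic⇒degreeSum≤ acyclic {S} = bound (length S) ≤-refl
    where
    bound : ∀ fuel {S} → length S ≤ fuel → Unique S → degreeSum S ≤ 2 * length S
    bound _          {[]}        _  _  = z≤n
    bound (suc fuel) {S@(s ∷ _)} S≤ uS with any? (λ u → degreeIn S u ≤? 1) S
    ... | no ¬leaf =
      let v , ys , cycle = minDegree≥2⇒cycle uS (All.map ≰⇒> (¬Any⇒All¬ S ¬leaf)) (here refl)
      in ⊥-elim (acyclic v ys cycle)
    ... | yes leaf with u , u∈S , deg≤1 ← find leaf with as , bs , S≡ ← ∈-∃++ u∈S =
      subst (λ S → degreeSum S ≤ 2 * length S) (sym S≡)
        (removeLeaf as u bs (subst (λ S → degreeIn S u ≤ 1) S≡ deg≤1)
          (bound fuel (≤-pred (subst (_≤ suc fuel) (trans (cong length S≡) (length-remove as u bs)) S≤))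
                      (Unique-remove as bs (subst Unique S≡ uS))))

module _ {n : ℕ} (G : Graph n) where

  open import Data.List.Membership.DecPropositional (_≟_ {n}) using (_∈?_)

  edgeSumIn : List (Fin n) → ℕ
  edgeSumIn S = ∑[ x ∈ S ] ∑[ y ∈ S ] χ (Adj G x y)

  module ColourClass {c} (col : Fin n → Fin n → Fin c) (col-sym : ∀ u v → col u v ≡ col v u) (i : Fin c) where

    inClass : Fin n → Fin n → Bool
    inClass x y = does (col x y ≟ i) ∧ Adj G x y

    inClass-sym : ∀ x y → inClass x y ≡ inClass y x
    inClass-sym x y = cong₂ (λ c b → does (c ≟ i) ∧ b) (col-sym x y) (Graph.sym G x y)

    inClass-irrefl : ∀ x → inClass x x ≡ false
    inClass-irrefl x = trans (cong (does (col x x ≟ i) ∧_) (Graph.irrefl G x)) (∧-zeroʳ _)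

    inClass⇒Edge : ∀ {x y} → inClass x y ≡ true → Edge G x y × col x y ≡ i
    inClass⇒Edge {x} {y} e with col x y ≟ i | Adj G x y | e
    ... | yes c≡i | true | _ = refl , c≡i

    open Acyclic inClass inClass-sym inClass-irrefl public

  arboricity⇒edgeSumIn≤ : ∀ {c} → ArboricityAtMost G c → ∀ {S} → Unique S → edgeSumIn S ≤ c * (2 * length S)
  arboricity⇒edgeSumIn≤ {c} (col , col-sym , acyclic) {S} uS = begin
    ∑[ x ∈ S ] ∑[ y ∈ S ] χ (Adj G x y)                          ≤⟨ ∑-mono-≤ (All.universal (λ x → ∑-mono-≤ (All.universal (χ-Adj≤ x) S)) S) ⟩
    ∑[ x ∈ S ] ∑[ y ∈ S ] ∑[ i ∈ allFin c ] χ (inClass i x y)    ≡⟨ ∑-cong S (λ x → ∑-swap S (allFin c) (λ y i → χ (inClass i x y))) ⟩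
    ∑[ x ∈ S ] ∑[ i ∈ allFin c ] ∑[ y ∈ S ] χ (inClass i x y)    ≡⟨ ∑-swap S (allFin c) _ ⟩
    ∑[ i ∈ allFin c ] degreeSum i S                              ≤⟨ ∑-mono-≤ (All.universal (λ i → acyclic⇒degreeSum≤ i (acyclicClass i) uS) (allFin c)) ⟩
    ∑[ _ ∈ allFin c ] (2 * length S)                             ≡⟨ ∑-const (allFin c) _ ⟩
    length (allFin c) * (2 * length S)                           ≡⟨ cong (_* (2 * length S)) (length-tabulate {n = c} (λ i → i)) ⟩
    c * (2 * length S)                                           ∎
    where
    open ≤-Reasoning
    open ColourClass col col-sym
    χ-Adj≤ : ∀ x y → χ (Adj G x y) ≤ ∑[ i ∈ allFin c ] χ (inClass i x y)
    χ-Adj≤ x y = subst (λ b → χ (b ∧ Adj G x y) ≤ ∑[ i ∈ allFin c ] χ (inClass i x y))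
                       (dec-true (col x y ≟ col x y) refl)
                       (∑-≥-term (λ i → χ (inClass i x y)) (∈-allFin (col x y)))
    acyclicClass : ∀ i v ys → ¬ IsCycle (_~_ i) v ys
    acyclicClass i v ys (u , l , linked) = acyclic i v ys (u , l , Linked.map (inClass⇒Edge i) linked)

  edgeSumBetween : List (Fin n) → List (Fin n) → ℕ
  edgeSumBetween S T = ∑[ x ∈ S ] ∑[ y ∈ T ] χ (Adj G x y)

  edgeSumBetween-sym : ∀ S T → edgeSumBetween S T ≡ edgeSumBetween T S
  edgeSumBetween-sym S T = trans (∑-swap S T _) (∑-cong T (λ y → ∑-cong S (λ x → cong χ (Graph.sym G x y))))

  edgeSumBetween-twice≤ : ∀ S T → edgeSumBetween S T + edgeSumBetween S T ≤ edgeSumIn (S ++ T)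
  edgeSumBetween-twice≤ S T = begin
    edgeSumBetween S T + edgeSumBetween S T
      ≡⟨ cong (edgeSumBetween S T +_) (edgeSumBetween-sym S T) ⟩
    edgeSumBetween S T + edgeSumBetween T S
      ≤⟨ +-mono-≤ (∑-mono-≤ (All.universal (λ x → m≤n+m _ _) S)) (∑-mono-≤ (All.universal (λ x → m≤m+n _ _) T)) ⟩
    ∑[ x ∈ S ] row x + ∑[ x ∈ T ] row x
      ≡⟨ ∑-++ S T row ⟨
    ∑[ x ∈ S ++ T ] row x
      ≡⟨ ∑-cong (S ++ T) (λ x → ∑-++ S T (χ ∘ Adj G x)) ⟨
    edgeSumIn (S ++ T)
      ∎
    where
    open ≤-Reasoning
    row : Fin n → ℕ
    row x = ∑[ y ∈ S ] χ (Adj G x y) + ∑[ y ∈ T ] χ (Adj G x y)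

  IsVertexCover : List (Fin n) → Set
  IsVertexCover C = ∀ {x y} → Edge G x y → x ∈ C ⊎ y ∈ C

  Edge-irrefl : ∀ {x y} → Edge G x y → x ≢ y
  Edge-irrefl {x} x~x refl with trans (sym (Graph.irrefl G x)) x~x
  ... | ()

  maximumMatching⇒vertexCover : ∀ {m} (max : IsMaxMatchingSize G m) →
                                IsVertexCover (endpoints (proj₁ (proj₁ max)))
  maximumMatching⇒vertexCover ((M , (edges , uC) , refl) , maximal) {x} {y} x~y
    with x ∈? endpoints M | y ∈? endpoints M
  ... | yes x∈C | _       = inj₁ x∈C
  ... | no _    | yes y∈C = inj₂ y∈C
  ... | no x∉C  | no y∉C  = ⊥-elim (1+n≰n (maximal ((x , y) ∷ M) (x~y ∷ edges , uC′)))
    where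
    uC′ : Unique (x ∷ y ∷ endpoints M)
    uC′ = (Edge-irrefl x~y ∷ ¬Any⇒All¬ _ x∉C) ∷ ¬Any⇒All¬ _ y∉C ∷ uC

  degree≤edgesToCover : ∀ {C x} → IsVertexCover C → x ∉ C → deg G x ≤ ∑[ y ∈ C ] χ (Adj G x y)
  degree≤edgesToCover {C} {x} cover x∉C = begin
    deg G x                           ≡⟨ sum-map (χ ∘ Adj G x) (allFin n) ⟩
    ∑[ y ∈ allFin n ] χ (Adj G x y)   ≤⟨ ∑-mono-support (χ ∘ Adj G x) (allFin⁺ n) neighbour∈C ⟩
    ∑[ y ∈ C ] χ (Adj G x y)          ∎
    where
    open ≤-Reasoning
    neighbour∈C : ∀ {y} → y ∈ allFin n → χ (Adj G x y) ≢ 0 → y ∈ C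
    neighbour∈C {y} _ χ≢0 with Adj G x y in x~y
    ... | false = ⊥-elim (χ≢0 refl)
    ... | true with cover x~y
    ...   | inj₁ x∈C = ⊥-elim (x∉C x∈C)
    ...   | inj₂ y∈C = y∈C

  fewHighOutsideCover : ∀ {c μ C H} → ArboricityAtMost G c → IsVertexCover C → Unique C → Unique H →
                        All (λ x → μ < deg G x × x ∉ C) H → length H * suc μ ≤ c * (length H + length C)
  fewHighOutsideCover {c} {μ} {C} {H} arb cover uC uH H-high = *-cancelˡ-≤ 2 (begin
    2 * (length H * suc μ)                         ≡⟨ cong (length H * suc μ +_) (+-identityʳ _) ⟩
    length H * suc μ + length H * suc μ            ≤⟨ +-mono-≤ H≤B H≤B ⟩
    edgeSumBetween H C + edgeSumBetween H C        ≤⟨ edgeSumBetween-twice≤ H C ⟩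
    edgeSumIn (H ++ C)                             ≤⟨ arboricity⇒edgeSumIn≤ arb (Unique-++⁺ uH uC disjoint) ⟩
    c * (2 * length (H ++ C))                      ≡⟨ cong (λ l → c * (2 * l)) (length-++ H) ⟩
    c * (2 * (length H + length C))                ≡⟨ x*[y*z]≡y*[x*z] c 2 _ ⟩
    2 * (c * (length H + length C))                ∎)
    where
    open ≤-Reasoning
    disjoint : Disjoint H C
    disjoint (x∈H , x∈C) = proj₂ (All.lookup H-high x∈H) x∈C
    H≤B : length H * suc μ ≤ edgeSumBetween H C
    H≤B = begin
      length H * suc μ   ≡⟨ ∑-const H (suc μ) ⟨
      ∑[ _ ∈ H ] suc μ   ≤⟨ ∑-mono-≤ (All.map (λ (μ<deg , x∉C) → ≤-trans μ<deg (degree≤edgesToCover cover x∉C)) H-high) ⟩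
      edgeSumBetween H C ∎

-- The hypothesis gives a (s + 1) ≤ c k, and c ≥ 1 gives s + 1 + c ≤ 2c + s.
weightedBound-core : ∀ c s a k → 1 ≤ c → a * suc (2 * c + s) ≤ c * (a + k) → (k + a) * (s + 1) ≤ (2 * c + s) * k
weightedBound-core c s a k 1≤c key = begin
  (k + a) * (s + 1)           ≡⟨ *-distribʳ-+ (s + 1) k a ⟩
  k * (s + 1) + a * (s + 1)   ≤⟨ +-monoʳ-≤ (k * (s + 1)) aD≤ck ⟩
  k * (s + 1) + c * k         ≡⟨ sym (eq₃ c s k) ⟩
  (s + (1 + c)) * k           ≤⟨ *-monoˡ-≤ k (+-monoʳ-≤ s 1+c≤2c) ⟩
  (s + 2 * c) * k             ≡⟨ cong (_* k) (+-comm s (2 * c)) ⟩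
  (2 * c + s) * k             ∎
  where
  open ≤-Reasoning
  eq₁ : ∀ c s a → a * suc (2 * c + s) ≡ a * (s + 1) + a * c + a * c
  eq₁ = solve-∀
  eq₂ : ∀ c a k → c * (a + k) ≡ a * c + c * k
  eq₂ = solve-∀
  eq₃ : ∀ c s k → (s + (1 + c)) * k ≡ k * (s + 1) + c * k
  eq₃ = solve-∀
  1+c≤2c : 1 + c ≤ 2 * c
  1+c≤2c = subst (1 + c ≤_) (cong (c +_) (sym (+-identityʳ c))) (+-monoˡ-≤ c 1≤c)
  aD≤ck : a * (s + 1) ≤ c * k
  aD≤ck = +-cancelʳ-≤ (a * c) (a * (s + 1)) (c * k) (begin
    a * (s + 1) + a * c               ≤⟨ m≤m+n _ (a * c) ⟩
    a * (s + 1) + a * c + a * c       ≡⟨ eq₁ c s a ⟨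
    a * suc (2 * c + s)               ≤⟨ key ⟩
    c * (a + k)                       ≡⟨ eq₂ c a k ⟩
    a * c + c * k                     ≡⟨ +-comm (a * c) (c * k) ⟩
    c * k + a * c                     ∎)

weightedBound : ∀ {c μ a k h} → 1 ≤ c → 2 * c ≤ μ → a * suc μ ≤ c * (a + k) → h ≤ k + a →
                h * (μ ∸ 2 * c + 1) ≤ μ * k
weightedBound {c} {μ} {a} {k} {h} 1≤c 2c≤μ key h≤k+a = begin
  h * (s + 1)         ≤⟨ *-monoˡ-≤ (s + 1) h≤k+a ⟩
  (k + a) * (s + 1)   ≤⟨ weightedBound-core c s a k 1≤c (subst (λ μ → a * suc μ ≤ c * (a + k)) (sym μ≡) key) ⟩
  (2 * c + s) * k     ≡⟨ cong (_* k) μ≡ ⟩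
  μ * k               ∎
  where
  open ≤-Reasoning
  s = μ ∸ 2 * c
  μ≡ : 2 * c + s ≡ μ
  μ≡ = m+[n∸m]≡n 2c≤μ

arboricity0⇒highCount≡0 : ∀ {n} (G : Graph n) μ → ArboricityAtMost G 0 → highCount G μ ≡ 0
arboricity0⇒highCount≡0 {zero}  G μ _         = refl
arboricity0⇒highCount≡0 {suc n} G μ (col , _) with col Fin.zero Fin.zero
... | ()

length-endpoints : ∀ {n} (M : List (Fin n × Fin n)) → length (endpoints M) ≡ 2 * length M
length-endpoints []      = refl
length-endpoints (_ ∷ M) = trans (cong (2 +_) (length-endpoints M)) (sym (*-suc 2 (length M)))

module _ {n : ℕ} (G : Graph n) (μ : ℕ) where

  open import Data.List.Membership.DecPropositional (_≟_ {n}) using (_∈?_)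

  High : Fin n → Set
  High v = (deg G v ≤ᵇ μ) ≡ false

  record LowHighSplit (M : List (Fin n × Fin n)) : Set where
    field
      lowEdges          : List (Fin n × Fin n)
      highEnds          : List (Fin n)
      lowEdges-matching : IsMatching (lowSubgraph G μ) lowEdges
      highEnds-unique   : Unique highEnds
      highEnds-high     : All High highEnds
      length-split      : length M ≡ length lowEdges + length highEnds
      lowEdges-⊆        : endpoints lowEdges ⊆ endpoints M
      highEnds-⊆        : highEnds ⊆ endpoints M

  splitMatching : ∀ M → IsMatching G M → LowHighSplit M
  splitMatching [] _ = record
    { lowEdges = []; highEnds = []; lowEdges-matching = [] , []; highEnds-unique = []
    ; highEnds-high = []; length-split = refl; lowEdges-⊆ = λ (); highEnds-⊆ = λ () }
  splitMatching ((u , v) ∷ M) (u~v ∷ edges , (u∉ ∷ v∉ ∷ uM))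
    with record { lowEdges = L ; highEnds = H ; lowEdges-matching = (L-edges , uL) ; highEnds-unique = uH
                ; highEnds-high = H-high ; length-split = len ; lowEdges-⊆ = L⊆ ; highEnds-⊆ = H⊆ }
         ← splitMatching M (edges , uM)
       | deg G u ≤ᵇ μ in u-low | deg G v ≤ᵇ μ in v-low
  ... | true | true = record
    { lowEdges = (u , v) ∷ L; highEnds = H
    ; lowEdges-matching = lowEdge ∷ L-edges , (All.head u∉ ∷ anti-mono L⊆ (All.tail u∉)) ∷ anti-mono L⊆ v∉ ∷ uL
    ; highEnds-unique = uH; highEnds-high = H-high; length-split = cong suc len
    ; lowEdges-⊆ = ∷⁺ʳ u (∷⁺ʳ v L⊆); highEnds-⊆ = there ∘′ there ∘′ H⊆ }
    where
    lowEdge : Edge (lowSubgraph G μ) u v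
    lowEdge rewrite u~v | u-low | v-low = refl
  ... | true | false = record
    { lowEdges = L; highEnds = v ∷ H; lowEdges-matching = L-edges , uL
    ; highEnds-unique = anti-mono H⊆ v∉ ∷ uH; highEnds-high = v-low ∷ H-high
    ; length-split = trans (cong suc len) (sym (+-suc _ _))
    ; lowEdges-⊆ = there ∘′ there ∘′ L⊆
    ; highEnds-⊆ = λ { (here refl) → there (here refl) ; (there w∈H) → there (there (H⊆ w∈H)) } }
  ... | false | _ = record
    { lowEdges = L; highEnds = u ∷ H; lowEdges-matching = L-edges , uL
    ; highEnds-unique = anti-mono H⊆ (All.tail u∉) ∷ uH; highEnds-high = u-low ∷ H-high
    ; length-split = trans (cong suc len) (sym (+-suc _ _))
    ; lowEdges-⊆ = there ∘′ there ∘′ L⊆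
    ; highEnds-⊆ = λ { (here refl) → here refl ; (there w∈H) → there (there (H⊆ w∈H)) } }

  highIndicator : Fin n → ℕ
  highIndicator v = if deg G v ≤ᵇ μ then 0 else 1

  highCount≡∑ : highCount G μ ≡ ∑ (allFin n) highIndicator
  highCount≡∑ = sum-map highIndicator (allFin n)

  length≤highCount : ∀ {hs} → Unique hs → All High hs → length hs ≤ highCount G μ
  length≤highCount {hs} uhs hs-high = begin
    length hs                     ≡⟨ length≡∑1 hs ⟩
    ∑[ _ ∈ hs ] 1                 ≤⟨ ∑-mono-≤ (All.map (λ high → ≤-reflexive (sym (cong (λ b → if b then 0 else 1) high))) hs-high) ⟩
    ∑ hs highIndicator            ≤⟨ ∑-mono-support highIndicator uhs (λ _ _ → ∈-allFin _) ⟩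
    ∑ (allFin n) highIndicator    ≡⟨ highCount≡∑ ⟨
    highCount G μ                 ∎
    where open ≤-Reasoning

  High⇒μ<deg : ∀ {v} → High v → μ < deg G v
  High⇒μ<deg high = ≰⇒> (λ deg≤μ → subst T high (≤⇒≤ᵇ deg≤μ))

  high? : ∀ v → Dec (High v)
  high? v = (deg G v ≤ᵇ μ) Bool.≟ false

  HighOutside : List (Fin n) → Fin n → Set
  HighOutside C v = High v × v ∉ C

  highOutside? : ∀ C v → Dec (HighOutside C v)
  highOutside? C v = high? v ×-dec ¬? (v ∈? C)

  highOutside : List (Fin n) → List (Fin n)
  highOutside C = filter (highOutside? C) (allFin n)

  highCount≤ : ∀ C → highCount G μ ≤ length C + length (highOutside C)
  highCount≤ C = begin
    highCount G μ                                ≡⟨ highCount≡∑ ⟩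
    ∑ (allFin n) highIndicator                   ≤⟨ ∑-mono-support highIndicator (allFin⁺ n) high∈ ⟩
    ∑ (C ++ highOutside C) highIndicator         ≤⟨ ∑-mono-≤ (All.universal indicator≤1 (C ++ highOutside C)) ⟩
    ∑[ _ ∈ C ++ highOutside C ] 1                ≡⟨ length≡∑1 (C ++ highOutside C) ⟨
    length (C ++ highOutside C)                  ≡⟨ length-++ C ⟩
    length C + length (highOutside C)            ∎
    where
    open ≤-Reasoning
    indicator≤1 : ∀ v → highIndicator v ≤ 1
    indicator≤1 v with deg G v ≤ᵇ μ
    ... | true  = z≤n
    ... | false = ≤-refl
    high∈ : ∀ {v} → v ∈ allFin n → highIndicator v ≢ 0 → v ∈ C ++ highOutside C
    high∈ {v} v∈ ind≢0 with deg G v ≤ᵇ μ in high | v ∈? C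
    ... | true  | _       = ⊥-elim (ind≢0 refl)
    ... | false | yes v∈C = ∈-++⁺ˡ v∈C
    ... | false | no  v∉C = ∈-++⁺ʳ C (∈-filter⁺ (highOutside? C) v∈ (high , v∉C))

  highCount-bound : ∀ {c Mstar} → ArboricityAtMost G c → 2 * c < μ → IsMaxMatchingSize G Mstar →
                    highCount G μ * (μ ∸ 2 * c + 1) ≤ μ * (2 * Mstar)
  highCount-bound {zero} arb _ _ rewrite arboricity0⇒highCount≡0 G μ arb = z≤n
  highCount-bound {suc c} arb 2c<μ max@((M , (_ , uC) , refl) , _) = begin
    highCount G μ * (μ ∸ 2 * suc c + 1)   ≤⟨ weightedBound (s≤s z≤n) (<⇒≤ 2c<μ) few (highCount≤ C) ⟩
    μ * length (endpoints M)              ≡⟨ cong (μ *_) (length-endpoints M) ⟩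
    μ * (2 * length M)                    ∎
    where
    open ≤-Reasoning
    C = endpoints M
    H = highOutside C
    few : length H * suc μ ≤ suc c * (length H + length C)
    few = fewHighOutsideCover G arb (maximumMatching⇒vertexCover G max) uC (filter⁺ (highOutside? C) (allFin⁺ n))
            (All.tabulate (λ v∈H → let _ , high , v∉C = ∈-filter⁻ (highOutside? C) {xs = allFin n} v∈H
                                   in High⇒μ<deg high , v∉C))

  lowMatching⇒matching : ∀ {M} → IsMatching (lowSubgraph G μ) M → IsMatching G M
  lowMatching⇒matching (edges , unique) = All.map (λ {(u , v)} → ∧-conicalˡ (Adj G u v) _) edges , unique

  maxMatching≤highCount+lowMatching : ∀ {Mstar Mμ} → IsMaxMatchingSize G Mstar →
    IsMaxMatchingSize (lowSubgraph G μ) Mμ → Mstar ≤ highCount G μ + Mμ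
  maxMatching≤highCount+lowMatching ((M , mM , refl) , _) (_ , maximalL) = begin
    length M                           ≡⟨ length-split ⟩
    length lowEdges + length highEnds  ≤⟨ +-mono-≤ (maximalL lowEdges lowEdges-matching) (length≤highCount highEnds-unique highEnds-high) ⟩
    _ + highCount G μ                  ≡⟨ +-comm _ (highCount G μ) ⟩
    highCount G μ + _                  ∎
    where
    open ≤-Reasoning
    open LowHighSplit (splitMatching M mM)

lemma2 : ∀ {n} (G : Graph n) (c μ Mstar Mμ : ℕ)
         → ArboricityAtMost G c
         → 2 * c < μ
         → IsMaxMatchingSize G Mstar
         → IsMaxMatchingSize (lowSubgraph G μ) Mμ
         → (Mstar ≤ highCount G μ + Mμ)
           × ((highCount G μ + Mμ) * (μ ∸ 2 * c + 1)
                ≤ (2 * μ + (μ ∸ 2 * c + 1)) * Mstar)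
lemma2 G c μ Mstar Mμ arb 2c<μ maxG maxL@((L , mL , refl) , _) =
  maxMatching≤highCount+lowMatching G μ maxG maxL , (begin
    (h + Mμ) * D                  ≡⟨ *-distribʳ-+ D h Mμ ⟩
    h * D + Mμ * D                ≤⟨ +-mono-≤ (highCount-bound G μ arb 2c<μ maxG) (*-monoˡ-≤ D Mμ≤Mstar) ⟩
    μ * (2 * Mstar) + Mstar * D   ≡⟨ rearrange μ Mstar D ⟩
    (2 * μ + D) * Mstar           ∎)
  where
  open ≤-Reasoning
  h = highCount G μ
  D = μ ∸ 2 * c + 1
  Mμ≤Mstar : Mμ ≤ Mstar
  Mμ≤Mstar = proj₂ maxG L (lowMatching⇒matching G μ mL)
  rearrange : ∀ μ m d → μ * (2 * m) + m * d ≡ (2 * μ + d) * m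
  rearrange = solve-∀
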